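{- Let $q$ be a prime power with $q\equiv 1\pmod 4$ and $q\not\equiv 1\pmod 3$, and let $x\in\mathbb{F}_{q^3}$ satisfy $\mathrm{T}(x)=\mathrm{T}(x^{q+1})=0$. (i) If $q\equiv 2\pmod 3$, then $x=0$. (ii) If $q=3^h$, then $x\in\mathbb{F}_q$.
   Context: $\mathrm{T}(x)=x+x^q+x^{q^2}$ is the trace from $\mathbb{F}_{q^3}$ to $\mathbb{F}_q$. -}

module Defs where

open import Level using (Level; _⊔_) renaming (suc to lsuc)
open import Data.Nat as ℕ using (ℕ; zero; suc; _^_; _≤_)
open import Data.Nat.Primality using (Prime)
open import Data.Fin using (Fin)
open import Data.Product using (Σ; ∃; _×_)
open import Relation.Binary.PropositionalEquality using (_≡_)
open import Relation.Nullary using (¬_)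
open import Algebra.Bundles using (CommutativeRing)

IsPrimePower : ℕ → Set
IsPrimePower q = Σ ℕ λ p → Σ ℕ λ h → Prime p × 1 ≤ h × q ≡ p ^ h

record FiniteField (c ℓ : Level) (n : ℕ) : Set (lsuc (c ⊔ ℓ)) where
  field
    commRing  : CommutativeRing c ℓ
  open CommutativeRing commRing public
  field
    0≉1       : ¬ (0# ≈ 1#)
    inverse   : ∀ x → ¬ (x ≈ 0#) → ∃ λ y → x * y ≈ 1#
    enum      : Fin n → Carrier
    enum-inj  : ∀ i j → enum i ≈ enum j → i ≡ j
    enum-surj : ∀ x → ∃ λ i → enum i ≈ x

  pow : Carrier → ℕ → Carrier
  pow x zero    = 1#
  pow x (suc k) = x * pow x k

module _ {c ℓ : Level} (q : ℕ) (F : FiniteField c ℓ (q ^ 3)) where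
  open FiniteField F

  trace : Carrier → Carrier
  trace x = x + pow x q + pow x (q ^ 2)

module Submission where

-- Let F be a field with q³ elements, x ∈ F, and write y = x^q, z = y^q for
-- the Frobenius conjugates of x, so that z^q = x.  The two hypotheses say
-- that the first two elementary symmetric functions of x, y, z vanish:
-- T(x) = x + y + z = 0 and T(x^(q+1)) = yx + zy + xz = 0.  Hence x, y, z are
-- roots of t³ − xyz, so x³ = y³ = z³.  Everything then reduces to the
-- injectivity of cubing on F:
--   (i)  if q ≡ 2 (mod 3) then |F| = q³ ≡ 2 (mod 3), so F has no nontrivial
--        cube root of unity, cubing is injective, x = y = z and 3x = 0;
--        the characteristic is not 3, hence x = 0;
--   (ii) if q = 3^h then F has characteristic 3, cubing is additive and has
--        trivial kernel, so y = x, i.e. x ∈ F_q.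

open import Defs
open import Level using (Level)
open import Data.Nat as ℕ using (ℕ; zero; suc)
import Data.Nat.Properties as ℕ
import Data.Nat.DivMod as ℕ
open import Data.Fin using (Fin; zero; suc; punchIn)
open import Data.Fin.Properties using (_≟_; punchInᵢ≢i; nonZeroIndex)
open import Data.Fin.Permutation using (Permutation; permutation; _⟨$⟩ʳ_)
open import Data.Product using (Σ; _×_; _,_; proj₁; proj₂)
open import Data.Sum using (_⊎_; inj₁; inj₂; [_,_]′)
open import Data.Empty using (⊥-elim)
open import Relation.Binary.PropositionalEquality as ≡ using (_≡_; _≢_; cong)
open import Relation.Nullary using (¬_; Dec; yes; no)
open import Algebra.Bundles using (CommutativeMonoid; CommutativeRing)
import Algebra.Properties.CommutativeMonoid.Sum as MonoidSum
import Algebra.Properties.Semiring.Exp as Exp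
import Algebra.Properties.Semiring.Mult as Mult
import Algebra.Properties.CommutativeSemiring.Exp as CommExp
import Algebra.Properties.Ring as RingProperties
import Algebra.Solver.Ring.NaturalCoefficients.Default as Solver
import Relation.Binary.Reasoning.Setoid as SetoidReasoning

module _ {a ℓ : Level} (M : CommutativeMonoid a ℓ) where
  open CommutativeMonoid M
  open MonoidSum M using (sum; sum-remove; sum-cong-≋; sum-replicate-zero)
  open SetoidReasoning setoid

  sum-concentrated : ∀ {m} (t : Fin m → Carrier) (i : Fin m) →
                     (∀ j → j ≢ i → t j ≈ ε) → sum t ≈ t i
  sum-concentrated {suc m} t i elsewhere = begin
    sum t                                ≈⟨ sum-remove {i = i} t ⟩
    t i ∙ sum (λ j → t (punchIn i j))    ≈⟨ ∙-congˡ (sum-cong-≋ (λ j → elsewhere _ (punchInᵢ≢i i j))) ⟩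
    t i ∙ sum {m} (λ _ → ε)              ≈⟨ ∙-congˡ (sum-replicate-zero m) ⟩
    t i ∙ ε                              ≈⟨ identityʳ (t i) ⟩
    t i                                  ∎

-- Vieta for three elements of a commutative ring: if the first two
-- elementary symmetric functions of x, y, z vanish, then x, y, z are roots
-- of t³ − xyz, since (t − x)(t − y)(t − z) = t³ − e₁t² + e₂t − xyz.
module _ {c ℓ : Level} (R : CommutativeRing c ℓ) where
  open CommutativeRing R
  open Exp semiring using (_^_)
  open Solver commutativeSemiring using (solve; _:+_; _:*_; _:^_; _:=_)
  open SetoidReasoning setoid

  cubes-of-roots : ∀ {x y z} → x + y + z ≈ 0# → y * x + z * y + x * z ≈ 0# →
                   x ^ 3 ≈ x * y * z × y ^ 3 ≈ x * y * z × z ^ 3 ≈ x * y * z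
  cubes-of-roots {x} {y} {z} e₁≈0 e₂≈0 =
      root x (solve 3 (λ x y z → x :^ 3 :+ (y :* x :+ z :* y :+ x :* z) :* x
                                 := (x :+ y :+ z) :* x :^ 2 :+ x :* y :* z) refl x y z)
    , root y (solve 3 (λ x y z → y :^ 3 :+ (y :* x :+ z :* y :+ x :* z) :* y
                                 := (x :+ y :+ z) :* y :^ 2 :+ x :* y :* z) refl x y z)
    , root z (solve 3 (λ x y z → z :^ 3 :+ (y :* x :+ z :* y :+ x :* z) :* z
                                 := (x :+ y :+ z) :* z :^ 2 :+ x :* y :* z) refl x y z)
    where
    root : ∀ t → t ^ 3 + (y * x + z * y + x * z) * t ≈ (x + y + z) * t ^ 2 + x * y * z →
           t ^ 3 ≈ x * y * z
    root t vieta = begin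
      t ^ 3                                        ≈⟨ +-identityʳ _ ⟨
      t ^ 3 + 0#                                   ≈⟨ +-congˡ (trans (*-congʳ e₂≈0) (zeroˡ t)) ⟨
      t ^ 3 + (y * x + z * y + x * z) * t          ≈⟨ vieta ⟩
      (x + y + z) * t ^ 2 + x * y * z              ≈⟨ +-congʳ (trans (*-congʳ e₁≈0) (zeroˡ _)) ⟩
      0# + x * y * z                               ≈⟨ +-identityˡ _ ⟩
      x * y * z                                    ∎

^-mod : ∀ m k d .{{_ : ℕ.NonZero d}} → (m ℕ.^ k) ℕ.% d ≡ ((m ℕ.% d) ℕ.^ k) ℕ.% d
^-mod m zero    d = ≡.refl
^-mod m (suc k) d = begin
  (m ℕ.* m ℕ.^ k) ℕ.% d                               ≡⟨ ℕ.%-distribˡ-* m (m ℕ.^ k) d ⟩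
  (m ℕ.% d ℕ.* ((m ℕ.^ k) ℕ.% d)) ℕ.% d               ≡⟨ cong (λ r → (m ℕ.% d ℕ.* r) ℕ.% d) (^-mod m k d) ⟩
  (m ℕ.% d ℕ.* (((m ℕ.% d) ℕ.^ k) ℕ.% d)) ℕ.% d       ≡⟨ cong (λ r → (r ℕ.* (((m ℕ.% d) ℕ.^ k) ℕ.% d)) ℕ.% d) (ℕ.m%n%n≡m%n m d) ⟨
  ((m ℕ.% d) ℕ.% d ℕ.* (((m ℕ.% d) ℕ.^ k) ℕ.% d)) ℕ.% d ≡⟨ ℕ.%-distribˡ-* (m ℕ.% d) ((m ℕ.% d) ℕ.^ k) d ⟨
  ((m ℕ.% d) ℕ.* (m ℕ.% d) ℕ.^ k) ℕ.% d                ∎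
  where open ≡.≡-Reasoning

cube-mod-3 : ∀ m → m ℕ.% 3 ≡ 2 → (m ℕ.^ 3) ℕ.% 3 ≡ 2
cube-mod-3 m m≡2 = ≡.trans (^-mod m 3 3) (cong (λ r → (r ℕ.^ 3) ℕ.% 3) m≡2)

mod-3≡2 : ∀ m → m ℕ.% 3 ≡ 2 → m ≡ 2 ℕ.+ 3 ℕ.* (m ℕ./ 3)
mod-3≡2 m m≡2 = ≡.trans (ℕ.m≡m%n+[m/n]*n m 3)
                        (≡.cong₂ ℕ._+_ m≡2 (ℕ.*-comm (m ℕ./ 3) 3))

module FiniteFieldProperties {c ℓ : Level} {n : ℕ} (F : FiniteField c ℓ n) where
  open FiniteField F hiding (zero)
  open RingProperties ring using (+-identityˡ-unique; x∙y⁻¹≈ε⇒x≈y; [y-z]x≈yx-zx)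
  open Exp semiring using (_^_; ^-congˡ; ^-congʳ; ^-homo-*; ^-assocʳ)
  open CommExp commutativeSemiring using (^-distrib-*)
  open Mult semiring using (×1-homo-*; ×-homo-+; ×-assoc-*; ×-congʳ) renaming (_×_ to _·_)
  open Solver commutativeSemiring using (solve; con; _:+_; _:*_; _:^_; _:=_)
  open SetoidReasoning setoid
  module Σ⁺ = MonoidSum +-commutativeMonoid
  module Π = MonoidSum *-commutativeMonoid

  pow≡^ : ∀ x k → pow x k ≡ x ^ k
  pow≡^ x zero    = ≡.refl
  pow≡^ x (suc k) = cong (x *_) (pow≡^ x k)

  index : Carrier → Fin n
  index x = proj₁ (enum-surj x)

  enum-index : ∀ x → enum (index x) ≈ x
  enum-index x = proj₂ (enum-surj x)

  index-cong : ∀ {x y} → x ≈ y → index x ≡ index y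
  index-cong {x} {y} x≈y = enum-inj _ _ (trans (enum-index x) (trans x≈y (sym (enum-index y))))

  index-enum : ∀ i → index (enum i) ≡ i
  index-enum i = enum-inj _ _ (enum-index (enum i))

  _≈?_ : ∀ x y → Dec (x ≈ y)
  x ≈? y with index x ≟ index y
  ... | yes same = yes (trans (sym (enum-index x)) (trans (reflexive (cong enum same)) (enum-index y)))
  ... | no differ = no (λ x≈y → differ (index-cong x≈y))

  reindex : (f f⁻¹ : Carrier → Carrier) →
            (∀ {a b} → a ≈ b → f a ≈ f b) → (∀ {a b} → a ≈ b → f⁻¹ a ≈ f⁻¹ b) →
            (∀ a → f (f⁻¹ a) ≈ a) → (∀ a → f⁻¹ (f a) ≈ a) →
            Σ (Permutation n n) λ π → ∀ i → enum (π ⟨$⟩ʳ i) ≈ f (enum i)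
  reindex f f⁻¹ f-cong f⁻¹-cong f∘f⁻¹ f⁻¹∘f = permutation to from to∘from from∘to , λ i → enum-index _
    where
    to from : Fin n → Fin n
    to i   = index (f (enum i))
    from i = index (f⁻¹ (enum i))
    to∘from : ∀ i → to (from i) ≡ i
    to∘from i = ≡.trans (index-cong (trans (f-cong (enum-index _)) (f∘f⁻¹ (enum i)))) (index-enum i)
    from∘to : ∀ i → from (to i) ≡ i
    from∘to i = ≡.trans (index-cong (trans (f⁻¹-cong (enum-index _)) (f⁻¹∘f (enum i)))) (index-enum i)

  -- The characteristic divides n: translation by 1 permutes F, so
  -- Σₐ (1 + a) = Σₐ a, i.e. n·1 + Σₐ a = Σₐ a.
  characteristic : n · 1# ≈ 0#
  characteristic = +-identityˡ-unique (n · 1#) (Σ⁺.sum enum) (sym (begin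
    Σ⁺.sum enum                          ≈⟨ Σ⁺.sum-permute enum π ⟩
    Σ⁺.sum (λ i → enum (π ⟨$⟩ʳ i))       ≈⟨ Σ⁺.sum-cong-≋ shift ⟩
    Σ⁺.sum {n} (λ i → 1# + enum i)       ≈⟨ Σ⁺.∑-distrib-+ (λ _ → 1#) enum ⟩
    Σ⁺.sum {n} (λ _ → 1#) + Σ⁺.sum enum  ≈⟨ +-congʳ (Σ⁺.sum-replicate n) ⟩
    n · 1# + Σ⁺.sum enum                 ∎))
    where
    cancel : ∀ u v a → u + v ≈ 0# → u + (v + a) ≈ a
    cancel u v a u+v≈0 = trans (sym (+-assoc u v a)) (trans (+-congʳ u+v≈0) (+-identityˡ a))
    translation : Σ (Permutation n n) λ π → ∀ i → enum (π ⟨$⟩ʳ i) ≈ 1# + enum i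
    translation = reindex (1# +_) (- 1# +_) +-congˡ +-congˡ
                          (λ a → cancel 1# (- 1#) a (-‿inverseʳ 1#))
                          (λ a → cancel (- 1#) 1# a (-‿inverseˡ 1#))
    π : Permutation n n
    π = proj₁ translation
    shift : ∀ i → enum (π ⟨$⟩ʳ i) ≈ 1# + enum i
    shift = proj₂ translation

  zero-divisor : ∀ {a b} → a * b ≈ 0# → a ≈ 0# ⊎ b ≈ 0#
  zero-divisor {a} {b} ab≈0 with a ≈? 0#
  ... | yes a≈0 = inj₁ a≈0
  ... | no a≉0  = inj₂ (begin
    b                ≈⟨ *-identityˡ b ⟨
    1# * b           ≈⟨ *-congʳ (proj₂ (inverse a a≉0)) ⟨
    (a * a⁻¹) * b    ≈⟨ *-congʳ (*-comm a a⁻¹) ⟩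
    (a⁻¹ * a) * b    ≈⟨ *-assoc a⁻¹ a b ⟩
    a⁻¹ * (a * b)    ≈⟨ *-congˡ ab≈0 ⟩
    a⁻¹ * 0#         ≈⟨ zeroʳ a⁻¹ ⟩
    0#               ∎)
    where a⁻¹ = proj₁ (inverse a a≉0)

  product-nonzero : ∀ {m} (t : Fin m → Carrier) → (∀ i → ¬ t i ≈ 0#) → ¬ Π.sum t ≈ 0#
  product-nonzero {zero}  t t≉0 1≈0 = 0≉1 (sym 1≈0)
  product-nonzero {suc m} t t≉0 Πt≈0 =
    [ t≉0 zero , product-nonzero (λ i → t (suc i)) (λ i → t≉0 (suc i)) ]′ (zero-divisor Πt≈0)

  *-cancelʳ : ∀ {a b c} → ¬ c ≈ 0# → a * c ≈ b * c → a ≈ b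
  *-cancelʳ {a} {b} {c} c≉0 ac≈bc = x∙y⁻¹≈ε⇒x≈y a b
    ([ (λ a-b≈0 → a-b≈0) , (λ c≈0 → ⊥-elim (c≉0 c≈0)) ]′ (zero-divisor (begin
      (a - b) * c      ≈⟨ [y-z]x≈yx-zx c a b ⟩
      a * c - b * c    ≈⟨ +-congʳ ac≈bc ⟩
      b * c - b * c    ≈⟨ -‿inverseʳ (b * c) ⟩
      0#               ∎)))

  no-nilpotents : ∀ {a} k → a ^ k ≈ 0# → a ≈ 0#
  no-nilpotents zero    1≈0 = ⊥-elim (0≉1 (sym 1≈0))
  no-nilpotents (suc k) aᵏ⁺¹≈0 = [ (λ a≈0 → a≈0) , no-nilpotents k ]′ (zero-divisor aᵏ⁺¹≈0)

  zeroCase : Carrier → Carrier → Carrier → Carrier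
  zeroCase a u v with a ≈? 0#
  ... | yes _ = u
  ... | no _  = v

  zeroCase-zero : ∀ {a} u v → a ≈ 0# → zeroCase a u v ≈ u
  zeroCase-zero {a} u v a≈0 with a ≈? 0#
  ... | yes _   = refl
  ... | no a≉0  = ⊥-elim (a≉0 a≈0)

  zeroCase-nonzero : ∀ {a} u v → ¬ a ≈ 0# → zeroCase a u v ≈ v
  zeroCase-nonzero {a} u v a≉0 with a ≈? 0#
  ... | yes a≈0 = ⊥-elim (a≉0 a≈0)
  ... | no _    = refl

  unzero : Carrier → Carrier
  unzero a = zeroCase a 1# a

  unzero-cong : ∀ {a b} → a ≈ b → unzero a ≈ unzero b
  unzero-cong {a} {b} a≈b with b ≈? 0#
  ... | yes b≈0 = zeroCase-zero 1# a (trans a≈b b≈0)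
  ... | no b≉0  = trans (zeroCase-nonzero 1# a (λ a≈0 → b≉0 (trans (sym a≈b) a≈0))) a≈b

  unzero-nonzero : ∀ a → ¬ unzero a ≈ 0#
  unzero-nonzero a with a ≈? 0#
  ... | yes _   = λ 1≈0 → 0≉1 (sym 1≈0)
  ... | no a≉0  = a≉0

  scale-unzero : ∀ {g} → ¬ g ≈ 0# → ∀ a → g * unzero a ≈ zeroCase a g 1# * unzero (g * a)
  scale-unzero {g} g≉0 a with a ≈? 0#
  ... | yes a≈0 = begin
    g * 1#              ≈⟨ *-congˡ (zeroCase-zero 1# (g * a) (trans (*-congˡ a≈0) (zeroʳ g))) ⟨
    g * unzero (g * a)  ∎
  ... | no a≉0  = begin
    g * a               ≈⟨ zeroCase-nonzero 1# (g * a) ga≉0 ⟨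
    unzero (g * a)      ≈⟨ *-identityˡ _ ⟨
    1# * unzero (g * a) ∎
    where
    ga≉0 : ¬ g * a ≈ 0#
    ga≉0 ga≈0 = [ g≉0 , a≉0 ]′ (zero-divisor ga≈0)

  -- For g ≠ 0,
  -- multiplication by g permutes F, and comparing Πₐ g·unzero(a) with
  -- Πₐ unzero(g·a) gives g^n · P = g · P with P = Πₐ unzero(a) ≠ 0.
  fermat : ∀ g → g ^ n ≈ g
  fermat g with g ≈? 0#
  ... | yes g≈0 = trans (^-congˡ n g≈0) (trans (zero-power n) (sym g≈0))
    where
    zero-power : ∀ k .{{_ : ℕ.NonZero k}} → 0# ^ k ≈ 0#
    zero-power (suc k) = zeroˡ _
    instance
      n≢0 : ℕ.NonZero n
      n≢0 = nonZeroIndex (index 0#)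
  ... | no g≉0  = *-cancelʳ (P≉0) (begin
    g ^ n * P                                                 ≈⟨ *-congʳ (Π.sum-replicate n) ⟨
    Π.sum {n} (λ _ → g) * P                                   ≈⟨ Π.∑-distrib-+ (λ _ → g) (λ i → unzero (enum i)) ⟨
    Π.sum (λ i → g * unzero (enum i))                         ≈⟨ Π.sum-cong-≋ (λ i → scale-unzero g≉0 (enum i)) ⟩
    Π.sum (λ i → zeroCase (enum i) g 1# * unzero (g * enum i)) ≈⟨ Π.∑-distrib-+ (λ i → zeroCase (enum i) g 1#) _ ⟩
    Π.sum (λ i → zeroCase (enum i) g 1#) * Π.sum (λ i → unzero (g * enum i)) ≈⟨ *-cong factor-g permuted ⟩
    g * P                                                     ∎)
    where
    P : Carrier
    P = Π.sum (λ i → unzero (enum i))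
    g⁻¹ : Carrier
    g⁻¹ = proj₁ (inverse g g≉0)
    gg⁻¹≈1 : g * g⁻¹ ≈ 1#
    gg⁻¹≈1 = proj₂ (inverse g g≉0)
    cancel : ∀ u v a → u * v ≈ 1# → u * (v * a) ≈ a
    cancel u v a uv≈1 = trans (sym (*-assoc u v a)) (trans (*-congʳ uv≈1) (*-identityˡ a))
    scaling : Σ (Permutation n n) λ π → ∀ i → enum (π ⟨$⟩ʳ i) ≈ g * enum i
    scaling = reindex (g *_) (g⁻¹ *_) *-congˡ *-congˡ
                      (λ a → cancel g g⁻¹ a gg⁻¹≈1)
                      (λ a → cancel g⁻¹ g a (trans (*-comm g⁻¹ g) gg⁻¹≈1))
    P≉0 : ¬ P ≈ 0#
    P≉0 = product-nonzero (λ i → unzero (enum i)) (λ i → unzero-nonzero (enum i))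
    factor-g : Π.sum (λ i → zeroCase (enum i) g 1#) ≈ g
    factor-g = trans
      (sum-concentrated *-commutativeMonoid _ (index 0#)
        (λ j j≢0 → zeroCase-nonzero g 1# (λ e → j≢0 (≡.trans (≡.sym (index-enum j)) (index-cong e)))))
      (zeroCase-zero g 1# (enum-index 0#))
    permuted : Π.sum (λ i → unzero (g * enum i)) ≈ P
    permuted = sym (trans (Π.sum-permute _ (proj₁ scaling))
                          (Π.sum-cong-≋ (λ i → unzero-cong (proj₂ scaling i))))

  ^-of-one : ∀ {u} k → u ≈ 1# → u ^ k ≈ 1#
  ^-of-one zero    u≈1 = refl
  ^-of-one (suc k) u≈1 = trans (*-cong u≈1 (^-of-one k u≈1)) (*-identityˡ 1#)

  -- In characteristic 3 cubing is injective: with d = a − b,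
  -- a³ = (d + b)³ = d³ + b³ + 3(d²b + db²) = d³ + b³, so d³ = 0 and d = 0.
  cube-injective-char-3 : 3 · 1# ≈ 0# → ∀ {a b} → a ^ 3 ≈ b ^ 3 → a ≈ b
  cube-injective-char-3 three≈0 {a} {b} a³≈b³ =
    x∙y⁻¹≈ε⇒x≈y a b (no-nilpotents 3 (+-identityˡ-unique (d ^ 3) (b ^ 3) (begin
      d ^ 3 + b ^ 3                     ≈⟨ +-identityʳ _ ⟨
      d ^ 3 + b ^ 3 + 0#                ≈⟨ +-congˡ three-E≈0 ⟨
      d ^ 3 + b ^ 3 + 3 · E             ≈⟨ binomial ⟨
      (d + b) ^ 3                       ≈⟨ ^-congˡ 3 d+b≈a ⟩
      a ^ 3                             ≈⟨ a³≈b³ ⟩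
      b ^ 3                             ∎)))
    where
    d : Carrier
    d = a - b
    E : Carrier
    E = d ^ 2 * b + d * b ^ 2
    d+b≈a : d + b ≈ a
    d+b≈a = trans (+-assoc a (- b) b) (trans (+-congˡ (-‿inverseˡ b)) (+-identityʳ a))
    binomial : (d + b) ^ 3 ≈ d ^ 3 + b ^ 3 + 3 · E
    binomial = solve 2 (λ d b → let e = d :^ 2 :* b :+ d :* b :^ 2 in
                          (d :+ b) :^ 3 := d :^ 3 :+ b :^ 3 :+ (e :+ (e :+ (e :+ con 0))))
                       refl d b
    three-E≈0 : 3 · E ≈ 0#
    three-E≈0 = begin
      3 · E             ≈⟨ ×-congʳ 3 (*-identityˡ E) ⟨
      3 · (1# * E)      ≈⟨ ×-assoc-* 3 1# E ⟨
      3 · 1# * E        ≈⟨ *-congʳ three≈0 ⟩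
      0# * E            ≈⟨ zeroˡ E ⟩
      0#                ∎

  -- If n ≡ 2 (mod 3), the only cube root of unity in F is 1: writing
  -- n = 2 + 3k, w = w^n = w² (w³)^k = w², and w ≠ 0.
  cube-root-of-unity : n ℕ.% 3 ≡ 2 → ∀ {w} → w ^ 3 ≈ 1# → w ≈ 1#
  cube-root-of-unity n≡2 {w} w³≈1 = *-cancelʳ w≉0 (begin
    w * w                        ≈⟨ *-congˡ (*-identityʳ w) ⟨
    w ^ 2                        ≈⟨ *-identityʳ _ ⟨
    w ^ 2 * 1#                   ≈⟨ *-congˡ (^-of-one k w³≈1) ⟨
    w ^ 2 * (w ^ 3) ^ k          ≈⟨ *-congˡ (^-assocʳ w 3 k) ⟩
    w ^ 2 * w ^ (3 ℕ.* k)        ≈⟨ ^-homo-* w 2 (3 ℕ.* k) ⟨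
    w ^ (2 ℕ.+ 3 ℕ.* k)          ≈⟨ ^-congʳ w (mod-3≡2 n n≡2) ⟨
    w ^ n                        ≈⟨ fermat w ⟩
    w                            ≈⟨ *-identityˡ w ⟨
    1# * w                       ∎)
    where
    k : ℕ
    k = n ℕ./ 3
    w≉0 : ¬ w ≈ 0#
    w≉0 w≈0 = 0≉1 (trans (sym (trans (*-congʳ w≈0) (zeroˡ _))) w³≈1)

  -- If n ≡ 2 (mod 3), cubing is injective: for b ≠ 0, a·b⁻¹ is a cube root of unity.
  cube-injective-2-mod-3 : n ℕ.% 3 ≡ 2 → ∀ {a b} → a ^ 3 ≈ b ^ 3 → a ≈ b
  cube-injective-2-mod-3 n≡2 {a} {b} a³≈b³ with b ≈? 0#
  ... | yes b≈0 = trans (no-nilpotents 3 (trans a³≈b³ (trans (^-congˡ 3 b≈0) (zeroˡ _)))) (sym b≈0)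
  ... | no b≉0  = *-cancelʳ b⁻¹≉0 (trans (cube-root-of-unity n≡2 (begin
      (a * b⁻¹) ^ 3        ≈⟨ ^-distrib-* a b⁻¹ 3 ⟩
      a ^ 3 * b⁻¹ ^ 3      ≈⟨ *-congʳ a³≈b³ ⟩
      b ^ 3 * b⁻¹ ^ 3      ≈⟨ ^-distrib-* b b⁻¹ 3 ⟨
      (b * b⁻¹) ^ 3        ≈⟨ ^-of-one 3 bb⁻¹≈1 ⟩
      1#                   ∎)) (sym bb⁻¹≈1))
    where
    b⁻¹ : Carrier
    b⁻¹ = proj₁ (inverse b b≉0)
    bb⁻¹≈1 : b * b⁻¹ ≈ 1#
    bb⁻¹≈1 = proj₂ (inverse b b≉0)
    b⁻¹≉0 : ¬ b⁻¹ ≈ 0#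
    b⁻¹≉0 b⁻¹≈0 = 0≉1 (trans (sym (trans (*-congˡ b⁻¹≈0) (zeroʳ b))) bb⁻¹≈1)

  -- If n ≡ 2 (mod 3) then 3 ≠ 0 in F: otherwise 0 = n·1 = 2·1 + k·(3·1) = 2·1,
  -- and 1 = 3·1 − 2·1 = 0.
  three-nonzero : n ℕ.% 3 ≡ 2 → ¬ 3 · 1# ≈ 0#
  three-nonzero n≡2 three≈0 = 0≉1 (sym (begin
    1#                       ≈⟨ +-identityʳ 1# ⟨
    1# + 0#                  ≈⟨ +-congˡ two≈0 ⟨
    1# + 2 · 1#              ≈⟨ three≈0 ⟩
    0#                       ∎))
    where
    k : ℕ
    k = n ℕ./ 3
    two≈0 : 2 · 1# ≈ 0#
    two≈0 = begin
      2 · 1#                            ≈⟨ +-identityʳ _ ⟨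
      2 · 1# + 0#                       ≈⟨ +-congˡ (trans (*-congʳ three≈0) (zeroˡ _)) ⟨
      2 · 1# + 3 · 1# * k · 1#          ≈⟨ +-congˡ (×1-homo-* 3 k) ⟨
      2 · 1# + (3 ℕ.* k) · 1#           ≈⟨ ×-homo-+ 1# 2 (3 ℕ.* k) ⟨
      (2 ℕ.+ 3 ℕ.* k) · 1#              ≈⟨ reflexive (cong (_· 1#) (mod-3≡2 n n≡2)) ⟨
      n · 1#                            ≈⟨ characteristic ⟩
      0#                                ∎

  -- If n is a power of 3 then 3 = 0 in F, since (3·1)^k = 3^k·1 = n·1 = 0.
  three-zero : ∀ k → n ≡ 3 ℕ.^ k → 3 · 1# ≈ 0#
  three-zero k n≡3ᵏ = no-nilpotents k (begin
    (3 · 1#) ^ k        ≈⟨ ·1-homo-^ 3 k ⟨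
    (3 ℕ.^ k) · 1#      ≈⟨ reflexive (cong (_· 1#) n≡3ᵏ) ⟨
    n · 1#              ≈⟨ characteristic ⟩
    0#                  ∎)
    where
    ·1-homo-^ : ∀ m j → (m ℕ.^ j) · 1# ≈ (m · 1#) ^ j
    ·1-homo-^ m zero    = +-identityʳ 1#
    ·1-homo-^ m (suc j) = trans (×1-homo-* m (m ℕ.^ j)) (*-congˡ (·1-homo-^ m j))

module Conjugates {c ℓ : Level} (q : ℕ) (F : FiniteField c ℓ (q ℕ.^ 3)) where
  open FiniteField F hiding (zero)
  open FiniteFieldProperties F
  open Exp semiring using (_^_; ^-congˡ; ^-congʳ; ^-homo-*; ^-assocʳ)
  open CommExp commutativeSemiring using (^-distrib-*)
  open Mult semiring using (×-assoc-*; ×-congʳ) renaming (_×_ to _·_)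
  open SetoidReasoning setoid

  frobenius-cubed : ∀ a → ((a ^ q) ^ q) ^ q ≈ a
  frobenius-cubed a = begin
    ((a ^ q) ^ q) ^ q          ≈⟨ ^-congˡ q (^-assocʳ a q q) ⟩
    (a ^ (q ℕ.* q)) ^ q        ≈⟨ ^-assocʳ a (q ℕ.* q) q ⟩
    a ^ (q ℕ.* q ℕ.* q)        ≈⟨ ^-congʳ a q³ ⟩
    a ^ (q ℕ.^ 3)              ≈⟨ fermat a ⟩
    a                          ∎
    where
    q³ : q ℕ.* q ℕ.* q ≡ q ℕ.^ 3
    q³ = ≡.trans (ℕ.*-assoc q q q) (cong (λ m → q ℕ.* (q ℕ.* m)) (≡.sym (ℕ.*-identityʳ q)))

  trace-conjugates : ∀ a → trace q F a ≈ a + a ^ q + (a ^ q) ^ q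
  trace-conjugates a = +-cong (+-congˡ (reflexive (pow≡^ a q))) (begin
    pow a (q ℕ.^ 2)            ≡⟨ pow≡^ a (q ℕ.^ 2) ⟩
    a ^ (q ℕ.* (q ℕ.* 1))      ≈⟨ ^-congʳ a (cong (q ℕ.*_) (ℕ.*-identityʳ q)) ⟩
    a ^ (q ℕ.* q)              ≈⟨ ^-assocʳ a q q ⟨
    (a ^ q) ^ q                ∎)

  module _ {x : Carrier} (T[x]≈0 : trace q F x ≈ 0#)
           (T[x^q+1]≈0 : trace q F (pow x (q ℕ.+ 1)) ≈ 0#) where
    y z : Carrier
    y = x ^ q
    z = y ^ q

    -- x^(q+1) = yx has conjugates zy and xz.
    trace-of-x^q+1 : trace q F (pow x (q ℕ.+ 1)) ≈ y * x + z * y + x * z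
    trace-of-x^q+1 = begin
      trace q F w                        ≈⟨ trace-conjugates w ⟩
      w + w ^ q + (w ^ q) ^ q            ≈⟨ +-cong (+-cong w≈yx wᵠ≈zy) (trans (^-congˡ q wᵠ≈zy) (^-distrib-* z y q)) ⟩
      y * x + z * y + z ^ q * y ^ q      ≈⟨ +-congˡ (*-cong (frobenius-cubed x) refl) ⟩
      y * x + z * y + x * z              ∎
      where
      w : Carrier
      w = pow x (q ℕ.+ 1)
      w≈yx : w ≈ y * x
      w≈yx = trans (reflexive (pow≡^ x (q ℕ.+ 1))) (trans (^-homo-* x q 1) (*-congˡ (*-identityʳ x)))
      wᵠ≈zy : w ^ q ≈ z * y
      wᵠ≈zy = trans (^-congˡ q w≈yx) (^-distrib-* y x q)

    conjugates-sum : x + y + z ≈ 0#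
    conjugates-sum = trans (sym (trace-conjugates x)) T[x]≈0

    equal-cubes : y ^ 3 ≈ x ^ 3 × z ^ 3 ≈ x ^ 3
    equal-cubes = trans y³≈xyz (sym x³≈xyz) , trans z³≈xyz (sym x³≈xyz)
      where
      roots : x ^ 3 ≈ x * y * z × y ^ 3 ≈ x * y * z × z ^ 3 ≈ x * y * z
      roots = cubes-of-roots commRing conjugates-sum (trans (sym trace-of-x^q+1) T[x^q+1]≈0)
      x³≈xyz : x ^ 3 ≈ x * y * z
      x³≈xyz = proj₁ roots
      y³≈xyz : y ^ 3 ≈ x * y * z
      y³≈xyz = proj₁ (proj₂ roots)
      z³≈xyz : z ^ 3 ≈ x * y * z
      z³≈xyz = proj₂ (proj₂ roots)

    -- (i) For q ≡ 2 (mod 3): cubing is injective, so x = y = z, and 3x = 0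
    -- with 3 ≠ 0 in F.
    vanishes-if-2-mod-3 : q ℕ.% 3 ≡ 2 → x ≈ 0#
    vanishes-if-2-mod-3 q≡2 =
      [ (λ three≈0 → ⊥-elim (three-nonzero size≡2 three≈0)) , (λ x≈0 → x≈0) ]′ (zero-divisor (begin
        3 · 1# * x           ≈⟨ trans (×-assoc-* 3 1# x) (×-congʳ 3 (*-identityˡ x)) ⟩
        x + (x + (x + 0#))   ≈⟨ trans (+-congˡ (+-congˡ (+-identityʳ x))) (sym (+-assoc x x x)) ⟩
        x + x + x            ≈⟨ +-cong (+-congˡ y≈x) z≈x ⟨
        x + y + z            ≈⟨ conjugates-sum ⟩
        0#                   ∎))
      where
      size≡2 : q ℕ.^ 3 ℕ.% 3 ≡ 2
      size≡2 = cube-mod-3 q q≡2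
      y≈x : y ≈ x
      y≈x = cube-injective-2-mod-3 size≡2 (proj₁ equal-cubes)
      z≈x : z ≈ x
      z≈x = cube-injective-2-mod-3 size≡2 (proj₂ equal-cubes)

    fixed-if-power-of-3 : ∀ h → q ≡ 3 ℕ.^ h → y ≈ x
    fixed-if-power-of-3 h q≡3ʰ = cube-injective-char-3 (three-zero (h ℕ.* 3) size≡3ʰ³) (proj₁ equal-cubes)
      where
      size≡3ʰ³ : q ℕ.^ 3 ≡ 3 ℕ.^ (h ℕ.* 3)
      size≡3ʰ³ = ≡.trans (cong (ℕ._^ 3) q≡3ʰ) (ℕ.^-*-assoc 3 h 3)

open import Data.Nat using (_+_; _^_; _%_)

mainTheorem10 : ∀ {c ℓ} (q : ℕ) → IsPrimePower q → q % 4 ≡ 1 → ¬ (q % 3 ≡ 1) →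
    (F : FiniteField c ℓ (q ^ 3)) → (x : FiniteField.Carrier F) →
    FiniteField._≈_ F (trace q F x) (FiniteField.0# F) →
    FiniteField._≈_ F (trace q F (FiniteField.pow F x (q + 1))) (FiniteField.0# F) →
    (q % 3 ≡ 2 → FiniteField._≈_ F x (FiniteField.0# F))
    × ((Σ ℕ λ h → q ≡ 3 ^ h) → FiniteField._≈_ F (FiniteField.pow F x q) x)
mainTheorem10 q _ _ _ F x T[x]≈0 T[x^q+1]≈0 =
    vanishes-if-2-mod-3 T[x]≈0 T[x^q+1]≈0
  , λ (h , q≡3ʰ) → trans (reflexive (pow≡^ x q)) (fixed-if-power-of-3 T[x]≈0 T[x^q+1]≈0 h q≡3ʰ)
  where
  open FiniteField F using (trans; reflexive)
  open FiniteFieldProperties F using (pow≡^)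
  open Conjugates q F
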